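{- Let $k,n\ge 3$ be integers. Suppose the colored graph $H$ consists of two components: a blue edge $v_1v_2$ and an almost blue path on $t\ge 3$ vertices. Then Builder in the game $\tilde R_H(C_k,C_n)$ has a strategy such that either after at most $2$ rounds the host graph contains an almost blue path on $t+2$ vertices, or after at most $4$ rounds the host graph contains two vertex-disjoint graphs: a wish triangle and an almost blue path on $t-2$ vertices.
   Context: Online Ramsey game: Builder and Painter play on the infinite complete graph $K_{\mathbb N}$. For a colored graph $H$ (each edge red or blue), the game $\tilde R_H(G_1,G_2)$ starts with a copy of $H$ already drawn and colored on the board; in each round Builder selects a previously unselected edge and Painter colors it red or blue; the game ends as soon as the graph of all colored edges (the host graph) contains a red copy of $G_1$ or a blue copy of $G_2$. $C_k$ is the cycle on $k$ vertices. An almost blue path is a path with at most one red edge and all other edges blue. A wish triangle is a colored triangle $C_3$ whose three edges are either all red, or one red and two blue. -}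

module Defs where

open import Data.Nat using (ℕ; zero; suc; _+_; _≤_; _∸_)
open import Data.List using (List; []; _∷_; length; _∷ʳ_; replicate)
open import Data.List.Membership.Propositional using (_∈_; _∉_)
open import Data.List.Relation.Unary.Unique.Propositional using (Unique)
open import Data.Product using (Σ; _×_; _,_)
open import Data.Sum using (_⊎_)
open import Relation.Binary.PropositionalEquality using (_≡_; _≢_)
open import Relation.Nullary using (¬_)

data Color : Set where
  red blue : Color

-- A board (host graph) is the list of colored edges drawn so far; vertices are ℕ
-- (the vertex set of K_ℕ). An entry (u , v , c) is the edge uv colored c.
Board : Set
Board = List (ℕ × ℕ × Color)

Edge : Board → ℕ → ℕ → Color → Set
Edge B u v c = (u , v , c) ∈ B ⊎ (v , u , c) ∈ B

Selected : Board → ℕ → ℕ → Set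
Selected B u v = Σ Color λ c → Edge B u v c

reds : List Color → ℕ
reds [] = 0
reds (red ∷ cs) = suc (reds cs)
reds (blue ∷ cs) = reds cs

data PathIn (B : Board) : List ℕ → List Color → Set where
  single : ∀ x → PathIn B (x ∷ []) []
  cons   : ∀ {x y vs c cs} → Edge B x y c → PathIn B (y ∷ vs) cs →
           PathIn B (x ∷ y ∷ vs) (c ∷ cs)

AlmostBluePathOn : Board → List ℕ → Set
AlmostBluePathOn B vs = Unique vs × Σ (List Color) λ cs → PathIn B vs cs × reds cs ≤ 1

HasAlmostBluePath : Board → ℕ → Set
HasAlmostBluePath B s = Σ (List ℕ) λ vs → length vs ≡ s × AlmostBluePathOn B vs

HasMonoCycle : Board → Color → ℕ → Set
HasMonoCycle B c k = Σ ℕ λ x → Σ (List ℕ) λ ys →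
  length (x ∷ ys) ≡ k × Unique (x ∷ ys) × PathIn B ((x ∷ ys) ∷ʳ x) (replicate k c)

WishTriangle : Board → ℕ → ℕ → ℕ → Set
WishTriangle B a b c = Unique (a ∷ b ∷ c ∷ []) × Σ Color λ x → Σ Color λ y → Σ Color λ z →
  Edge B a b x × Edge B b c y × Edge B c a z ×
  (reds (x ∷ y ∷ z ∷ []) ≡ 3 ⊎ reds (x ∷ y ∷ z ∷ []) ≡ 1)

HasWishAndPath : Board → ℕ → Set
HasWishAndPath B s = Σ ℕ λ a → Σ ℕ λ b → Σ ℕ λ c → Σ (List ℕ) λ vs →
  WishTriangle B a b c × length vs ≡ s × AlmostBluePathOn B vs ×
  a ∉ vs × b ∉ vs × c ∉ vs

GameOver : ℕ → ℕ → Board → Set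
GameOver k n B = HasMonoCycle B red k ⊎ HasMonoCycle B blue n

-- Reach k n G i m B : in the game with targets (C_k, C_n), from host graph B
-- after i rounds have been played, Builder has a strategy guaranteeing that
-- within at most m further rounds, against every Painter, either G holds of
-- the current round count and host graph, or the game has ended.
data Reach (k n : ℕ) (G : ℕ → Board → Set) : ℕ → ℕ → Board → Set where
  stop : ∀ {i m B} → G i B → Reach k n G i m B
  over : ∀ {i m B} → GameOver k n B → Reach k n G i m B
  move : ∀ {i m B} (u v : ℕ) → u ≢ v → ¬ Selected B u v →
         ((c : Color) → Reach k n G (suc i) m ((u , v , c) ∷ B)) →
         Reach k n G i (suc m) B

pathEdges : List ℕ → List Color → Board
pathEdges (x ∷ y ∷ vs) (c ∷ cs) = (x , y , c) ∷ pathEdges (y ∷ vs) cs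
pathEdges _ _ = []

Goal15 : ℕ → ℕ → Board → Set
Goal15 t i B = (i ≤ 2 × HasAlmostBluePath B (t + 2)) ⊎ (i ≤ 4 × HasWishAndPath B (t ∸ 2))

-- Without a red edge, joining an end of the path to v₁ already gives an almost blue path
-- v₂ v₁ … on t + 2 vertices.  Otherwise the path is as · a · b · bs with ab its red edge and
-- Builder draws a v₁ and b v₂: unless both are red, as · a v₁ v₂ b · bs is almost blue.
-- If both are red, Builder draws a v₂; blue closes the wish triangle a v₁ v₂ (one red edge),
-- red the red triangle a b v₂.  Either triangle avoids the blue paths as and bs, which have
-- t − 2 vertices together and between which the board has no edge, so one more edge joins them.
module Submission where

open import Data.Nat using (ℕ; suc; _+_; _≤_; _∸_; z≤n; s≤s)
open import Data.Nat.Properties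
  using (+-comm; suc-injective; n≤0⇒n≡0; ≤-refl; ≤-trans; n≤1+n; m+[n∸m]≡n)
open import Data.List using (List; []; _∷_; _++_; _∷ʳ_; length; initLast; _∷ʳ′_)
open import Data.List.Properties using (++-assoc; ++-identityʳ)
open import Data.List.Membership.Propositional using (_∈_; _∉_)
open import Data.List.Membership.Propositional.Properties using (∈-++⁺ˡ; ∈-++⁺ʳ; ∈-++⁻)
open import Data.List.Relation.Binary.Disjoint.Propositional using (Disjoint)
open import Data.List.Relation.Binary.Subset.Propositional using (_⊆_)
open import Data.List.Relation.Unary.Any using (here; there)
open import Data.List.Relation.Unary.All.Properties using (¬Any⇒All¬; All¬⇒¬Any)
open import Data.List.Relation.Unary.AllPairs using ([]; _∷_)
open import Data.List.Relation.Unary.Unique.Propositional using (Unique)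
open import Data.List.Relation.Unary.Unique.Propositional.Properties using (Unique[x∷xs]⇒x∉xs)
open import Relation.Binary.PropositionalEquality
  using (_≡_; _≢_; refl; sym; trans; cong; subst; setoid; module ≡-Reasoning)
open import Data.List.Relation.Binary.Permutation.Setoid (setoid ℕ) using (_↭_; ↭-sym; ↭-trans)
open import Data.List.Relation.Binary.Permutation.Setoid.Properties (setoid ℕ)
  using (Unique-resp-↭; ∈-resp-↭; xs↭ys⇒|xs|≡|ys|; ↭-shift; shifts; ++⁺ˡ)
open import Data.Product using (Σ; _×_; _,_; proj₁; proj₂)
import Data.Product as Product
open import Data.Sum using (_⊎_; inj₁; inj₂)
import Data.Sum as Sum
open import Function using (_∘_)
open import Relation.Nullary using (¬_; contradiction)
open import Defs

∈∧∉⇒≢ : ∀ {x y : ℕ} {xs} → x ∈ xs → y ∉ xs → x ≢ y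
∈∧∉⇒≢ x∈ y∉ refl = y∉ x∈

∉-∷ : ∀ {v x : ℕ} {xs} → v ≢ x → v ∉ xs → v ∉ x ∷ xs
∉-∷ v≢x v∉ (here v≡x) = v≢x v≡x
∉-∷ v≢x v∉ (there v∈) = v∉ v∈

unique-∷ : ∀ {x : ℕ} {xs} → x ∉ xs → Unique xs → Unique (x ∷ xs)
unique-∷ {xs = xs} x∉ uniq = ¬Any⇒All¬ xs x∉ ∷ uniq

unique₃ : ∀ {x y z : ℕ} → x ≢ y → x ≢ z → y ≢ z → Unique (x ∷ y ∷ z ∷ [])
unique₃ x≢y x≢z y≢z =
  unique-∷ (∉-∷ x≢y (∉-∷ x≢z λ ())) (unique-∷ (∉-∷ y≢z λ ()) (unique-∷ (λ ()) []))

Unique-++⇒Disjoint : ∀ (xs : List ℕ) {ys} → Unique (xs ++ ys) → Disjoint xs ys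
Unique-++⇒Disjoint (x ∷ xs) (x∉ ∷ _) (here refl , v∈ys) = All¬⇒¬Any x∉ (∈-++⁺ʳ xs v∈ys)
Unique-++⇒Disjoint (x ∷ xs) (_ ∷ uniq) (there v∈xs , v∈ys) =
  Unique-++⇒Disjoint xs uniq (v∈xs , v∈ys)

shifts-after : ∀ P (x : ℕ) M Q → P ++ x ∷ M ++ Q ↭ M ++ P ++ x ∷ Q
shifts-after P x M Q = ↭-trans (++⁺ˡ P (↭-sym (↭-shift M Q))) (shifts P M)

edge-mono : ∀ {B B' u v c} → B ⊆ B' → Edge B u v c → Edge B' u v c
edge-mono B⊆B' = Sum.map B⊆B' B⊆B'

pathIn-mono : ∀ {B B' vs cs} → B ⊆ B' → PathIn B vs cs → PathIn B' vs cs
pathIn-mono B⊆B' (single x) = single x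
pathIn-mono B⊆B' (cons e p) = cons (edge-mono B⊆B' e) (pathIn-mono B⊆B' p)

unselected-sym : ∀ {B u w} → ¬ Selected B u w → ¬ Selected B w u
unselected-sym ¬uw (c , e) = ¬uw (c , Sum.swap e)

unselected-∷ : ∀ {B u w p q d} → u ≢ p → u ≢ q → ¬ Selected B u w →
  ¬ Selected ((p , q , d) ∷ B) u w
unselected-∷ u≢p u≢q ¬uw (c , inj₁ (here refl)) = u≢p refl
unselected-∷ u≢p u≢q ¬uw (c , inj₂ (here refl)) = u≢q refl
unselected-∷ u≢p u≢q ¬uw (c , inj₁ (there e)) = ¬uw (c , inj₁ e)
unselected-∷ u≢p u≢q ¬uw (c , inj₂ (there e)) = ¬uw (c , inj₂ e)

pathEdges-path : ∀ vs cs → suc (length cs) ≡ length vs → PathIn (pathEdges vs cs) vs cs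
pathEdges-path (x ∷ []) [] _ = single x
pathEdges-path (x ∷ y ∷ vs) (c ∷ cs) |cs| =
  cons (inj₁ (here refl)) (pathIn-mono there (pathEdges-path (y ∷ vs) cs (suc-injective |cs|)))
pathEdges-path [] _ ()
pathEdges-path (x ∷ []) (c ∷ cs) ()
pathEdges-path (x ∷ y ∷ vs) [] ()

pathEdges-endpoints : ∀ vs cs {u w c} → (u , w , c) ∈ pathEdges vs cs → u ∈ vs × w ∈ vs
pathEdges-endpoints (x ∷ y ∷ vs) (c ∷ cs) (here refl) = here refl , there (here refl)
pathEdges-endpoints (x ∷ y ∷ vs) (c ∷ cs) (there e) =
  Product.map there there (pathEdges-endpoints (y ∷ vs) cs e)

pathEdges-sides : ∀ P {x : ℕ} Q cs {u w c} → (u , w , c) ∈ pathEdges (P ++ x ∷ Q) cs →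
  (u ∈ P ∷ʳ x × w ∈ P ∷ʳ x) ⊎ (u ∈ x ∷ Q × w ∈ x ∷ Q)
pathEdges-sides [] Q cs e = inj₂ (pathEdges-endpoints _ cs e)
pathEdges-sides (p ∷ []) Q (c ∷ cs) (here refl) = inj₁ (here refl , there (here refl))
pathEdges-sides (p ∷ []) Q (c ∷ cs) (there e) = inj₂ (pathEdges-endpoints _ cs e)
pathEdges-sides (p ∷ p' ∷ P) Q (c ∷ cs) (here refl) = inj₁ (here refl , there (here refl))
pathEdges-sides (p ∷ p' ∷ P) Q (c ∷ cs) (there e) =
  Sum.map₁ (Product.map there there) (pathEdges-sides (p' ∷ P) Q cs e)

pathEdges-unselected-∉ : ∀ {vs} cs {u w} → u ∉ vs → ¬ Selected (pathEdges vs cs) u w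
pathEdges-unselected-∉ cs u∉ (_ , inj₁ e) = u∉ (proj₁ (pathEdges-endpoints _ cs e))
pathEdges-unselected-∉ cs u∉ (_ , inj₂ e) = u∉ (proj₂ (pathEdges-endpoints _ cs e))

pathEdges-unselected-across : ∀ P {x : ℕ} Q cs {u w} → u ∉ x ∷ Q → w ∉ P ∷ʳ x →
  ¬ Selected (pathEdges (P ++ x ∷ Q) cs) u w
pathEdges-unselected-across P Q cs u∉ w∉ (_ , inj₁ e) =
  Sum.[ w∉ ∘ proj₂ , u∉ ∘ proj₁ ] (pathEdges-sides P Q cs e)
pathEdges-unselected-across P Q cs u∉ w∉ (_ , inj₂ e) =
  Sum.[ w∉ ∘ proj₁ , u∉ ∘ proj₂ ] (pathEdges-sides P Q cs e)

H : ℕ → ℕ → List ℕ → List Color → Board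
H v₁ v₂ vs cs = (v₁ , v₂ , blue) ∷ pathEdges vs cs

H-unselected : ∀ {v₁ v₂ vs cs y v} → y ≢ v₁ → y ≢ v₂ → v ∉ vs →
  ¬ Selected (H v₁ v₂ vs cs) y v
H-unselected {cs = cs} y≢v₁ y≢v₂ v∉ =
  unselected-∷ y≢v₁ y≢v₂ (unselected-sym (pathEdges-unselected-∉ cs v∉))

reds-++ : ∀ xs ys → reds (xs ++ ys) ≡ reds xs + reds ys
reds-++ [] ys = refl
reds-++ (red ∷ xs) ys = cong suc (reds-++ xs ys)
reds-++ (blue ∷ xs) ys = reds-++ xs ys

reds-[c]≤1 : ∀ c → reds (c ∷ []) ≤ 1
reds-[c]≤1 red = ≤-refl
reds-[c]≤1 blue = z≤n

data BlueWalk (B : Board) : List ℕ → Set where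
  [_] : ∀ x → BlueWalk B (x ∷ [])
  _∷_ : ∀ {x y vs} → Edge B x y blue → BlueWalk B (y ∷ vs) → BlueWalk B (x ∷ y ∷ vs)

AlmostBlueWalk : Board → List ℕ → Set
AlmostBlueWalk B vs = Σ (List Color) λ cs → PathIn B vs cs × reds cs ≤ 1

blueWalk-mono : ∀ {B B' vs} → B ⊆ B' → BlueWalk B vs → BlueWalk B' vs
blueWalk-mono B⊆B' [ x ] = [ x ]
blueWalk-mono B⊆B' (e ∷ w) = edge-mono B⊆B' e ∷ blueWalk-mono B⊆B' w

blueWalk-tail : ∀ {B x y vs} → BlueWalk B (x ∷ y ∷ vs) → BlueWalk B (y ∷ vs)
blueWalk-tail (_ ∷ w) = w

blueWalk-init : ∀ {B} P {z a : ℕ} → BlueWalk B (P ∷ʳ z ∷ʳ a) → BlueWalk B (P ∷ʳ z)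
blueWalk-init [] _ = [ _ ]
blueWalk-init (x ∷ []) (e ∷ _) = e ∷ [ _ ]
blueWalk-init (x ∷ y ∷ P) (e ∷ w) = e ∷ blueWalk-init (y ∷ P) w

blueWalk⇒pathIn : ∀ {B vs} → BlueWalk B vs → Σ (List Color) λ cs → PathIn B vs cs × reds cs ≡ 0
blueWalk⇒pathIn [ x ] = [] , single x , refl
blueWalk⇒pathIn (e ∷ w) = Product.map (blue ∷_) (Product.map₁ (cons e)) (blueWalk⇒pathIn w)

pathIn⇒blueWalk : ∀ {B vs cs} → PathIn B vs cs → reds cs ≡ 0 → BlueWalk B vs
pathIn⇒blueWalk (single x) _ = [ x ]
pathIn⇒blueWalk (cons {c = blue} e p) r = e ∷ pathIn⇒blueWalk p r

blueWalk⇒almostBlueWalk : ∀ {B vs} → BlueWalk B vs → AlmostBlueWalk B vs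
blueWalk⇒almostBlueWalk w with cs , p , r ← blueWalk⇒pathIn w = cs , p , subst (_≤ 1) (sym r) z≤n

pathIn-++ : ∀ {B} P {x : ℕ} {R c₁ c₂} → PathIn B (P ∷ʳ x) c₁ → PathIn B (x ∷ R) c₂ →
  PathIn B (P ++ x ∷ R) (c₁ ++ c₂)
pathIn-++ [] (single _) q = q
pathIn-++ (p ∷ []) (cons e (single _)) q = cons e q
pathIn-++ (p ∷ p' ∷ P) (cons e rest) q = cons e (pathIn-++ (p' ∷ P) rest q)

almostBlueWalk-glue : ∀ {B} P {x M y Q ds} → BlueWalk B (P ∷ʳ x) → PathIn B (x ∷ (M ∷ʳ y)) ds →
  reds ds ≤ 1 → BlueWalk B (y ∷ Q) → AlmostBlueWalk B (P ++ x ∷ M ++ y ∷ Q)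
almostBlueWalk-glue P {x} {M} {ds = ds} before middle ≤1 after
  with cA , pA , rA ← blueWalk⇒pathIn before | cB , pB , rB ← blueWalk⇒pathIn after =
  cA ++ ds ++ cB , pathIn-++ P pA (pathIn-++ (x ∷ M) middle pB) , subst (_≤ 1) (sym reds≡) ≤1
  where
  open ≡-Reasoning
  reds≡ : reds (cA ++ ds ++ cB) ≡ reds ds
  reds≡ = begin
    reds (cA ++ ds ++ cB)         ≡⟨ reds-++ cA (ds ++ cB) ⟩
    reds cA + reds (ds ++ cB)     ≡⟨ cong (_+ reds (ds ++ cB)) rA ⟩
    reds (ds ++ cB)               ≡⟨ reds-++ ds cB ⟩
    reds ds + reds cB             ≡⟨ cong (reds ds +_) rB ⟩
    reds ds + 0                   ≡⟨ +-comm (reds ds) 0 ⟩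
    reds ds                       ∎

data RedEdgeSplit (B : Board) (vs : List ℕ) : Set where
  split : ∀ as {a b} bs → vs ≡ as ++ a ∷ b ∷ bs →
          BlueWalk B (as ∷ʳ a) → Edge B a b red → BlueWalk B (b ∷ bs) → RedEdgeSplit B vs

redEdgeSplit-∷ : ∀ {B x y vs} → Edge B x y blue → RedEdgeSplit B (y ∷ vs) →
  RedEdgeSplit B (x ∷ y ∷ vs)
redEdgeSplit-∷ e (split [] bs refl before r after) = split (_ ∷ []) bs refl (e ∷ before) r after
redEdgeSplit-∷ e (split (_ ∷ as) bs refl before r after) =
  split (_ ∷ _ ∷ as) bs refl (e ∷ before) r after

almostBlue-split : ∀ {B vs cs} → PathIn B vs cs → reds cs ≤ 1 → BlueWalk B vs ⊎ RedEdgeSplit B vs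
almostBlue-split (single x) _ = inj₁ [ x ]
almostBlue-split (cons {c = red} e p) (s≤s r) =
  inj₂ (split [] _ refl [ _ ] e (pathIn⇒blueWalk p (n≤0⇒n≡0 r)))
almostBlue-split (cons {c = blue} e p) r = Sum.map (e ∷_) (redEdgeSplit-∷ e) (almostBlue-split p r)

WishTriangleOutside : Board → List ℕ → Set
WishTriangleOutside B L =
  Σ ℕ λ p → Σ ℕ λ q → Σ ℕ λ r → WishTriangle B p q r × p ∉ L × q ∉ L × r ∉ L

wishTriangleOutside-mono : ∀ {B B' L} → B ⊆ B' → WishTriangleOutside B L → WishTriangleOutside B' L
wishTriangleOutside-mono B⊆B' (p , q , r , (uniq , x , y , z , pq , qr , rp , colours) , outside) =
  p , q , r ,
  (uniq , x , y , z , edge-mono B⊆B' pq , edge-mono B⊆B' qr , edge-mono B⊆B' rp , colours) , outside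

hasWishAndPath : ∀ {B L s} → WishTriangleOutside B L → length L ≡ s → Unique L → AlmostBlueWalk B L →
  HasWishAndPath B s
hasWishAndPath (p , q , r , W , p∉ , q∉ , r∉) |L| uniq walk =
  p , q , r , _ , W , |L| , (uniq , walk) , p∉ , q∉ , r∉

finalRound : ∀ {k n t B} → 3 ≤ t → ∀ as {a b} bs →
  WishTriangleOutside B (as ++ bs) → length (as ++ bs) ≡ t ∸ 2 → Unique (as ++ bs) →
  BlueWalk B (as ∷ʳ a) → BlueWalk B (b ∷ bs) →
  (∀ {u w} → u ∈ as → w ∈ bs → ¬ Selected B u w) →
  Reach k n (Goal15 t) 3 1 B
finalRound (s≤s (s≤s (s≤s _))) as bs W |L| uniq before after separated with initLast as | bs
... | [] | [] = contradiction |L| λ ()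
... | [] | b' ∷ bs' = stop (inj₂ (n≤1+n 3 , hasWishAndPath W |L| uniq bsWalk))
  where
  bsWalk : AlmostBlueWalk _ (b' ∷ bs')
  bsWalk = blueWalk⇒almostBlueWalk (blueWalk-tail after)
... | as' ∷ʳ′ z | [] = stop (inj₂ (n≤1+n 3 , hasWishAndPath W |L| uniq asWalk))
  where
  asWalk : AlmostBlueWalk _ ((as' ∷ʳ z) ++ [])
  asWalk = subst (AlmostBlueWalk _) (sym (++-identityʳ (as' ∷ʳ z)))
    (blueWalk⇒almostBlueWalk (blueWalk-init as' before))
... | as' ∷ʳ′ z | b' ∷ bs' =
  move z b' (λ z≡b' → Unique-++⇒Disjoint (as' ∷ʳ z) uniq (z∈ , here z≡b'))
    (separated z∈ (here refl)) λ c →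
  stop (inj₂ (≤-refl , hasWishAndPath (wishTriangleOutside-mono there W) |L| uniq (joined c)))
  where
  z∈ : z ∈ as' ∷ʳ z
  z∈ = ∈-++⁺ʳ as' (here refl)
  joined : ∀ c → AlmostBlueWalk ((z , b' , c) ∷ _) ((as' ∷ʳ z) ++ b' ∷ bs')
  joined c = subst (AlmostBlueWalk _) (sym (++-assoc as' (z ∷ []) (b' ∷ bs')))
    (almostBlueWalk-glue as' {M = []} (blueWalk-mono there (blueWalk-init as' before))
      (cons (inj₁ (here refl)) (single b')) (reds-[c]≤1 c) (blueWalk-mono there (blueWalk-tail after)))

blueStrategy : ∀ {k n t v₁ v₂ x r cs} → v₁ ≢ v₂ → v₁ ∉ x ∷ r → v₂ ∉ x ∷ r →
  Unique (x ∷ r) → length (x ∷ r) ≡ t → BlueWalk (H v₁ v₂ (x ∷ r) cs) (x ∷ r) →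
  Reach k n (Goal15 t) 0 4 (H v₁ v₂ (x ∷ r) cs)
blueStrategy {t = t} {v₁} {v₂} {x} {r} v₁≢v₂ v₁∉ v₂∉ uniq |vs| walk =
  move x v₁ x≢v₁ (H-unselected x≢v₁ (λ x≡v₂ → v₂∉ (here (sym x≡v₂))) v₁∉) λ c →
  stop (inj₁ (n≤1+n 1 , v₂ ∷ v₁ ∷ x ∷ r , trans (cong (suc ∘ suc) |vs|) (+-comm 2 t) ,
    unique-∷ (∉-∷ (v₁≢v₂ ∘ sym) v₂∉) (unique-∷ v₁∉ uniq) ,
    almostBlueWalk-glue [] {M = v₁ ∷ []} [ v₂ ]
      (cons (inj₂ (there (here refl))) (cons (inj₂ (here refl)) (single x)))
      (reds-[c]≤1 c) (blueWalk-mono there walk)))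
  where
  x≢v₁ : x ≢ v₁
  x≢v₁ x≡v₁ = v₁∉ (here (sym x≡v₁))

module RedEdgeStrategy
  (k n t : ℕ) (3≤t : 3 ≤ t) (v₁ v₂ : ℕ) (as : List ℕ) (a b : ℕ) (bs : List ℕ) (cs : List Color)
  (v₁≢v₂ : v₁ ≢ v₂) (v₁∉ : v₁ ∉ as ++ a ∷ b ∷ bs) (v₂∉ : v₂ ∉ as ++ a ∷ b ∷ bs)
  (uniq : Unique (as ++ a ∷ b ∷ bs)) (|vs| : length (as ++ a ∷ b ∷ bs) ≡ t)
  (before : BlueWalk (H v₁ v₂ (as ++ a ∷ b ∷ bs) cs) (as ∷ʳ a))
  (redEdge : Edge (H v₁ v₂ (as ++ a ∷ b ∷ bs) cs) a b red)
  (after : BlueWalk (H v₁ v₂ (as ++ a ∷ b ∷ bs) cs) (b ∷ bs))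
  where

  vs : List ℕ
  vs = as ++ a ∷ b ∷ bs

  B₀ : Board
  B₀ = H v₁ v₂ vs cs

  vs↭ : vs ↭ a ∷ b ∷ as ++ bs
  vs↭ = shifts as (a ∷ b ∷ [])

  uniq-ab : Unique (a ∷ b ∷ as ++ bs)
  uniq-ab = Unique-resp-↭ vs↭ uniq

  uniq-ends : Unique (as ++ bs)
  uniq-ends with _ ∷ _ ∷ u ← uniq-ab = u

  a∉ : a ∉ b ∷ as ++ bs
  a∉ = Unique[x∷xs]⇒x∉xs uniq-ab

  b∉ : b ∉ as ++ bs
  b∉ with _ ∷ u ← uniq-ab = Unique[x∷xs]⇒x∉xs u

  outside : ∀ {v} → v ∉ vs → v ∉ a ∷ b ∷ as ++ bs
  outside v∉ = v∉ ∘ ∈-resp-↭ (↭-sym vs↭)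

  a≢b : a ≢ b
  a≢b = a∉ ∘ here

  ≢v₁ : ∀ {y} → y ∈ a ∷ b ∷ as ++ bs → y ≢ v₁
  ≢v₁ y∈ = ∈∧∉⇒≢ y∈ (outside v₁∉)

  ≢v₂ : ∀ {y} → y ∈ a ∷ b ∷ as ++ bs → y ≢ v₂
  ≢v₂ y∈ = ∈∧∉⇒≢ y∈ (outside v₂∉)

  a∈ : a ∈ a ∷ b ∷ as ++ bs
  a∈ = here refl

  b∈ : b ∈ a ∷ b ∷ as ++ bs
  b∈ = there (here refl)

  B₁ : Color → Board
  B₁ c₁ = (a , v₁ , c₁) ∷ B₀

  B₂ : Color → Color → Board
  B₂ c₁ c₂ = (b , v₂ , c₂) ∷ B₁ c₁

  B₃ : Color → Board
  B₃ y = (a , v₂ , y) ∷ B₂ red red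

  B₀⊆B₃ : ∀ {y} → B₀ ⊆ B₃ y
  B₀⊆B₃ = there ∘ there ∘ there

  longPath : ∀ c₁ c₂ → reds (c₁ ∷ blue ∷ c₂ ∷ []) ≤ 1 →
    HasAlmostBluePath (B₂ c₁ c₂) (t + 2)
  longPath c₁ c₂ ≤1 =
    as ++ a ∷ v₁ ∷ v₂ ∷ b ∷ bs ,
    trans (xs↭ys⇒|xs|≡|ys| long↭) (trans (cong (suc ∘ suc) |vs|) (+-comm 2 t)) ,
    Unique-resp-↭ (↭-sym long↭) (unique-∷ (∉-∷ v₁≢v₂ v₁∉) (unique-∷ v₂∉ uniq)) ,
    almostBlueWalk-glue as {M = v₁ ∷ v₂ ∷ []} (blueWalk-mono B₀⊆ before)
      (cons (inj₁ (there (here refl)))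
        (cons (inj₁ (there (there (here refl)))) (cons (inj₂ (here refl)) (single b))))
      ≤1 (blueWalk-mono B₀⊆ after)
    where
    B₀⊆ : B₀ ⊆ B₂ c₁ c₂
    B₀⊆ = there ∘ there
    long↭ : as ++ a ∷ v₁ ∷ v₂ ∷ b ∷ bs ↭ v₁ ∷ v₂ ∷ vs
    long↭ = shifts-after as a (v₁ ∷ v₂ ∷ []) (b ∷ bs)

  wishTriangle : ∀ y → WishTriangleOutside (B₃ y) (as ++ bs)
  wishTriangle blue =
    a , v₁ , v₂ ,
    (unique₃ (≢v₁ a∈) (≢v₂ a∈) v₁≢v₂ , red , blue , blue ,
      inj₁ (there (there (here refl))) , inj₁ (there (there (there (here refl)))) ,
      inj₂ (here refl) , inj₂ refl) ,
    a∉ ∘ there , outside v₁∉ ∘ there ∘ there , outside v₂∉ ∘ there ∘ there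
  wishTriangle red =
    a , b , v₂ ,
    (unique₃ a≢b (≢v₂ a∈) (≢v₂ b∈) , red , red , red ,
      edge-mono B₀⊆B₃ redEdge , inj₁ (there (here refl)) , inj₂ (here refl) , inj₁ refl) ,
    a∉ ∘ there , b∉ , outside v₂∉ ∘ there ∘ there

  separated : ∀ y {u w} → u ∈ as → w ∈ bs → ¬ Selected (B₃ y) u w
  separated y {u} {w} u∈as w∈bs =
    unselected-∷ u≢a (≢v₂ u∈) (unselected-∷ u≢b (≢v₂ u∈) (unselected-∷ u≢a (≢v₁ u∈)
      (unselected-∷ (≢v₁ u∈) (≢v₂ u∈)
        (pathEdges-unselected-across as (b ∷ bs) cs (λ u∈abbs → disjoint (u∈as , u∈abbs)) w∉))))
    where
    disjoint : Disjoint as (a ∷ b ∷ bs)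
    disjoint = Unique-++⇒Disjoint as uniq
    u∈ : u ∈ a ∷ b ∷ as ++ bs
    u∈ = there (there (∈-++⁺ˡ u∈as))
    u≢a : u ≢ a
    u≢a = ∈∧∉⇒≢ (there (∈-++⁺ˡ u∈as)) a∉
    u≢b : u ≢ b
    u≢b = ∈∧∉⇒≢ (∈-++⁺ˡ u∈as) b∉
    w∉ : w ∉ as ∷ʳ a
    w∉ w∈ with ∈-++⁻ as w∈
    ... | inj₁ w∈as = disjoint (w∈as , there (there w∈bs))
    ... | inj₂ (here refl) = a∉ (there (∈-++⁺ʳ as w∈bs))

  afterTwoRounds : ∀ c₁ c₂ → Reach k n (Goal15 t) 2 2 (B₂ c₁ c₂)
  afterTwoRounds blue c₂ = stop (inj₁ (≤-refl , longPath blue c₂ (reds-[c]≤1 c₂)))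
  afterTwoRounds red blue = stop (inj₁ (≤-refl , longPath red blue ≤-refl))
  afterTwoRounds red red =
    move a v₂ (≢v₂ a∈)
      (unselected-∷ a≢b (≢v₂ a∈)
        (unselected-sym (unselected-∷ (≢v₂ a∈ ∘ sym) (v₁≢v₂ ∘ sym)
          (unselected-sym (H-unselected (≢v₁ a∈) (≢v₂ a∈) v₂∉))))) λ y →
    finalRound 3≤t as bs (wishTriangle y)
      (cong (_∸ 2) (trans (sym (xs↭ys⇒|xs|≡|ys| vs↭)) |vs|)) uniq-ends
      (blueWalk-mono B₀⊆B₃ before) (blueWalk-mono B₀⊆B₃ after) (separated y)

  strategy : Reach k n (Goal15 t) 0 4 B₀
  strategy =
    move a v₁ (≢v₁ a∈) (H-unselected (≢v₁ a∈) (≢v₂ a∈) v₁∉) λ c₁ →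
    move b v₂ (≢v₂ b∈)
      (unselected-∷ (a≢b ∘ sym) (≢v₁ b∈) (H-unselected (≢v₁ b∈) (≢v₂ b∈) v₂∉))
      (afterTwoRounds c₁)

lemma15 : (k n t : ℕ) → 3 ≤ k → 3 ≤ n → 3 ≤ t →
    (v₁ v₂ : ℕ) (vs : List ℕ) (cs : List Color) →
    v₁ ≢ v₂ → v₁ ∉ vs → v₂ ∉ vs → Unique vs →
    length vs ≡ t → length cs ≡ t ∸ 1 → reds cs ≤ 1 →
    Reach k n (Goal15 t) 0 4 ((v₁ , v₂ , blue) ∷ pathEdges vs cs)
lemma15 k n t _ _ 3≤t v₁ v₂ vs cs v₁≢v₂ v₁∉ v₂∉ uniq |vs| |cs| reds≤1
  with almostBlue-split (pathEdges-path vs cs |cs|+1) reds≤1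
  where
  |cs|+1 : suc (length cs) ≡ length vs
  |cs|+1 = trans (cong suc |cs|) (trans (m+[n∸m]≡n (≤-trans (s≤s z≤n) 3≤t)) (sym |vs|))
... | inj₂ (split as bs refl before redEdge after) =
  RedEdgeStrategy.strategy k n t 3≤t v₁ v₂ as _ _ bs cs v₁≢v₂ v₁∉ v₂∉ uniq |vs|
    (blueWalk-mono there before) (edge-mono there redEdge) (blueWalk-mono there after)
lemma15 k n t _ _ 3≤t v₁ v₂ (_ ∷ _) cs v₁≢v₂ v₁∉ v₂∉ uniq |vs| |cs| reds≤1 | inj₁ walk =
  blueStrategy v₁≢v₂ v₁∉ v₂∉ uniq |vs| (blueWalk-mono there walk)
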